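{- Models for $\mathrm{CTT}_{\mathrm{qe}}$ exist; that is, there exists an interpretation $\mathcal{M}=(\{D_\alpha \mid \alpha\in\mathcal{T}\}, I)$ of $\mathrm{CTT}_{\mathrm{qe}}$ together with a valuation function $V^{\mathcal{M}}$ satisfying all six conditions in the definition of a model given in the context.
   Context: $\mathrm{CTT}_{\mathrm{qe}}$ is a version of Church's type theory with quotation and evaluation. Types: $\iota$ (individuals), $o$ (truth values), $\epsilon$ (constructions) are types, and if $\alpha,\beta$ are types then $(\alpha\to\beta)$ is a type; $\mathcal{T}$ is the set of types. A typed symbol is a symbol with a subscript from $\mathcal{T}$. $\mathcal{V}$ is a set of typed symbols containing denumerably many with each subscript $\alpha$ (the variables $\mathbf{x}_\alpha$ of type $\alpha$). $\mathcal{C}$ is a set of typed symbols disjoint from $\mathcal{V}$ (the constants $\mathbf{c}_\alpha$) containing the logical constants $=_{\alpha\to\alpha\to o}$ (for every $\alpha$), $\mathrm{is\text{ - }var}_{\epsilon\to o}$, $\mathrm{is\text{ - }con}_{\epsilon\to o}$, $\mathrm{app}_{\epsilon\to\epsilon\to\epsilon}$, $\mathrm{abs}_{\epsilon\to\epsilon\to\epsilon}$, $\mathrm{quo}_{\epsilon\to\epsilon}$, and $\mathrm{is\text{ - }expr}^{\alpha}_{\epsilon\to o}$ (for every $\alpha$). Expressions (of type indicated by the subscript): $\mathbf{x}_\alpha$ and $\mathbf{c}_\alpha$ are expressions of type $\alpha$; $(\mathbf{F}_{\alpha\to\beta}\,\mathbf{A}_\alpha)$ has type $\beta$; $(\lambda\,\mathbf{x}_\alpha.\,\mathbf{B}_\beta)$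 has type $\alpha\to\beta$; the quotation $\ulcorner\mathbf{A}_\alpha\urcorner$ has type $\epsilon$ provided $\mathbf{A}_\alpha$ is eval-free; the evaluation $[\![\mathbf{A}_\epsilon]\!]_{\mathbf{B}_\beta}$ has type $\beta$, abbreviated $[\![\mathbf{A}_\epsilon]\!]_\beta$. An expression is eval-free if built using only the first five rules (no evaluation). Formulas are expressions of type $o$. Constructions: $\ulcorner\mathbf{x}_\alpha\urcorner$ and $\ulcorner\mathbf{c}_\alpha\urcorner$ are constructions; if $\mathbf{A}_\epsilon,\mathbf{B}_\epsilon$ are constructions then so are $\mathrm{app}\,\mathbf{A}_\epsilon\,\mathbf{B}_\epsilon$, $\mathrm{abs}\,\mathbf{A}_\epsilon\,\mathbf{B}_\epsilon$, $\mathrm{quo}\,\mathbf{A}_\epsilon$. The injective map $\mathcal{E}$ from eval-free expressions to constructions is: $\mathcal{E}(\mathbf{x}_\alpha)=\ulcorner\mathbf{x}_\alpha\urcorner$, $\mathcal{E}(\mathbf{c}_\alpha)=\ulcorner\mathbf{c}_\alpha\urcorner$, $\mathcal{E}(\mathbf{F}\,\mathbf{A})=\mathrm{app}\,\mathcal{E}(\mathbf{F})\,\mathcal{E}(\mathbf{A})$, $\mathcal{E}(\lambda\,\mathbf{x}_\alpha.\mathbf{B})=\mathrm{abs}\,\mathcal{E}(\mathbf{x}_\alpha)\,\mathcal{E}(\mathbf{B})$, $\mathcal{E}(\ulcorner\mathbf{A}\urcorner)=\mathrm{quo}\,\mathcal{E}(\mathbf{A})$. Frame: domains $D_\iota$ a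 nonempty set, $D_o=\{\mathrm{T},\mathrm{F}\}$, $D_\epsilon$ the set of constructions, $D_{\alpha\to\beta}$ the set of all total functions $D_\alpha\to D_\beta$. Interpretation: a frame plus $I$ mapping each constant of type $\alpha$ into $D_\alpha$ such that $I(=_{\alpha\to\alpha\to o})$ is identity on $D_\alpha$; $I(\mathrm{is\text{ - }var})(\mathbf{A})=\mathrm{T}$ iff $\mathbf{A}=\ulcorner\mathbf{x}_\alpha\urcorner$ for some variable; $I(\mathrm{is\text{ - }con})(\mathbf{A})=\mathrm{T}$ iff $\mathbf{A}=\ulcorner\mathbf{c}_\alpha\urcorner$ for some constant; $I(\mathrm{app})(\mathbf{A})(\mathbf{B})$ is the construction $\mathrm{app}\,\mathbf{A}\,\mathbf{B}$; similarly for $\mathrm{abs}$ and $\mathrm{quo}$; $I(\mathrm{is\text{ - }expr}^\alpha)(\mathbf{A})=\mathrm{T}$ iff $\mathbf{A}=\mathcal{E}(\mathbf{B}_\alpha)$ for some eval-free expression $\mathbf{B}_\alpha$ of type $\alpha$. An assignment $\phi$ maps each variable $\mathbf{x}_\alpha$ into $D_\alpha$; $\phi[\mathbf{x}_\alpha\mapsto d]$ is the usual update. Model: an interpretation $\mathcal{M}$ is a model if there is a function $V^{\mathcal{M}}$ with $V^{\mathcal{M}}_\phi(\mathbf{C}_\gamma)\in D_\gamma$ for all assignments $\phi$ and expressions $\mathbf{C}_\gamma$ such that: (1) $V_\phi(\mathbf{x}_\alpha)=\phi(\mathbf{x}_\alpha)$; (2) $V_\phi(\mathbf{c}_\alpha)=I(\mathbf{c}_\alpha)$;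 (3) $V_\phi(\mathbf{F}\,\mathbf{A})=V_\phi(\mathbf{F})(V_\phi(\mathbf{A}))$; (4) $V_\phi(\lambda\,\mathbf{x}_\alpha.\mathbf{B}_\beta)$ is the function $d\mapsto V_{\phi[\mathbf{x}_\alpha\mapsto d]}(\mathbf{B}_\beta)$; (5) $V_\phi(\ulcorner\mathbf{A}_\alpha\urcorner)=\mathcal{E}(\mathbf{A}_\alpha)$; (6) if $V_\phi(\mathrm{is\text{ - }expr}^\beta_{\epsilon\to o}\,\mathbf{A}_\epsilon)=\mathrm{T}$ then $V_\phi([\![\mathbf{A}_\epsilon]\!]_\beta)=V_\phi(\mathcal{E}^{ -1}(V_\phi(\mathbf{A}_\epsilon)))$ (no constraint otherwise beyond lying in $D_\beta$). -}

module Defs where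

open import Data.Bool using (Bool; true; false)
open import Data.Nat using (ℕ)
open import Data.Nat.Properties using () renaming (_≟_ to _≟ℕ_)
open import Data.Product using (Σ; _,_)
open import Function.Bundles using (_⇔_)
open import Relation.Binary.PropositionalEquality using (_≡_; refl; subst)
open import Relation.Nullary using (yes; no)
open import Relation.Binary.Definitions using (DecidableEquality)

-- Types of CTT_qe : ι (individuals), o (truth values), ε (constructions), α ⇒ β
data Ty : Set where
  ι o ε : Ty
  _⇒_ : Ty → Ty → Ty

infixr 20 _⇒_

_≟Ty_ : DecidableEquality Ty
ι ≟Ty ι = yes refl
ι ≟Ty o = no λ ()
ι ≟Ty ε = no λ ()
ι ≟Ty (_ ⇒ _) = no λ ()
o ≟Ty ι = no λ ()
o ≟Ty o = yes refl
o ≟Ty ε = no λ ()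
o ≟Ty (_ ⇒ _) = no λ ()
ε ≟Ty ι = no λ ()
ε ≟Ty o = no λ ()
ε ≟Ty ε = yes refl
ε ≟Ty (_ ⇒ _) = no λ ()
(_ ⇒ _) ≟Ty ι = no λ ()
(_ ⇒ _) ≟Ty o = no λ ()
(_ ⇒ _) ≟Ty ε = no λ ()
(a ⇒ b) ≟Ty (c ⇒ d) with a ≟Ty c | b ≟Ty d
... | yes refl | yes refl = yes refl
... | no ne | _ = no λ { refl → ne refl }
... | yes _ | no ne = no λ { refl → ne refl }

-- The language, parametrised by the family Sym α of NON-logical constants of
-- type α (an arbitrary set of typed symbols).
module Lang (Sym : Ty → Set) where

  data Con : Ty → Set where
    eqC      : (α : Ty) → Con (α ⇒ α ⇒ o)
    is-varC  : Con (ε ⇒ o)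
    is-conC  : Con (ε ⇒ o)
    appC     : Con (ε ⇒ ε ⇒ ε)
    absC     : Con (ε ⇒ ε ⇒ ε)
    quoC     : Con (ε ⇒ ε)
    is-exprC : (α : Ty) → Con (ε ⇒ o)
    sym      : ∀ {α} → Sym α → Con α

  -- Expr b α : expressions of type α; b = false means eval-free,
  -- b = true means arbitrary expressions (evaluation allowed).
  data Expr : Bool → Ty → Set where
    var  : ∀ {b} (α : Ty) → ℕ → Expr b α
    con  : ∀ {b α} → Con α → Expr b α
    app  : ∀ {b α β} → Expr b (α ⇒ β) → Expr b α → Expr b β
    lam  : ∀ {b β} (α : Ty) → ℕ → Expr b β → Expr b (α ⇒ β)
    quo  : ∀ {b α} → Expr false α → Expr b ε
    eval : ∀ {β} → Expr true ε → Expr true β → Expr true β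

  embed : ∀ {α} → Expr false α → Expr true α
  embed (var α n) = var α n
  embed (con c) = con c
  embed (app F A) = app (embed F) (embed A)
  embed (lam α n B) = lam α n (embed B)
  embed (quo A) = quo A

  data Constr : Set where
    qvar : Ty → ℕ → Constr
    qcon : ∀ {α} → Con α → Constr
    capp : Constr → Constr → Constr
    cabs : Constr → Constr → Constr
    cquo : Constr → Constr

  ℰ : ∀ {α} → Expr false α → Constr
  ℰ (var α n) = qvar α n
  ℰ (con c) = qcon c
  ℰ (app F A) = capp (ℰ F) (ℰ A)
  ℰ (lam α n B) = cabs (qvar α n) (ℰ B)
  ℰ (quo A) = cquo (ℰ A)

  IsVar : Constr → Set
  IsVar A = Σ Ty λ α → Σ ℕ λ n → A ≡ qvar α n

  IsCon : Constr → Set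
  IsCon A = Σ Ty λ α → Σ (Con α) λ c → A ≡ qcon c

  IsExpr : Ty → Constr → Set
  IsExpr α A = Σ (Expr false α) λ B → ℰ B ≡ A

  module Frame (Dι : Set) where

    D : Ty → Set
    D ι = Dι
    D o = Bool
    D ε = Constr
    D (α ⇒ β) = D α → D β

    Assignment : Set
    Assignment = (α : Ty) → ℕ → D α

    update : Assignment → (α : Ty) → ℕ → D α → Assignment
    update φ α n d β m with β ≟Ty α
    ... | no _ = φ β m
    ... | yes refl with m ≟ℕ n
    ...   | yes _ = d
    ...   | no _ = φ β m

    record IsInterpretation (I : ∀ {α} → Con α → D α) : Set where
      field
        eq-ok      : ∀ α (x y : D α) → (I (eqC α) x y ≡ true) ⇔ (x ≡ y)
        is-var-ok  : ∀ A → (I is-varC A ≡ true) ⇔ IsVar A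
        is-con-ok  : ∀ A → (I is-conC A ≡ true) ⇔ IsCon A
        app-ok     : ∀ A B → I appC A B ≡ capp A B
        abs-ok     : ∀ A B → I absC A B ≡ cabs A B
        quo-ok     : ∀ A → I quoC A ≡ cquo A
        is-expr-ok : ∀ α A → (I (is-exprC α) A ≡ true) ⇔ IsExpr α A

    record IsValuation (I : ∀ {α} → Con α → D α)
                       (V : Assignment → ∀ {γ} → Expr true γ → D γ) : Set where
      field
        V-var  : ∀ φ α n → V φ (var α n) ≡ φ α n
        V-con  : ∀ φ {α} (c : Con α) → V φ (con c) ≡ I c
        V-app  : ∀ φ {α β} (F : Expr true (α ⇒ β)) (A : Expr true α) →
                 V φ (app F A) ≡ V φ F (V φ A)
        V-lam  : ∀ φ α n {β} (B : Expr true β) (d : D α) →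
                 V φ (lam α n B) d ≡ V (update φ α n d) B
        V-quo  : ∀ φ {α} (A : Expr false α) → V φ (quo A) ≡ ℰ A
        -- if V φ (is-expr^β A) = T, i.e. V φ A = ℰ C for an eval-free C of
        -- type β (C = ℰ⁻¹(V φ A), unique since ℰ is injective), then
        -- V φ ⟦A⟧_B = V φ C
        V-eval : ∀ φ {β} (A : Expr true ε) (B : Expr true β) →
                 V φ (app (con (is-exprC β)) A) ≡ true →
                 (C : Expr false β) → ℰ C ≡ V φ A →
                 V φ (eval A B) ≡ V φ (embed C)

record Model (Sym : Ty → Set) : Set₁ where
  open Lang Sym
  field
    Dι    : Set
    point : Dι
  open Frame Dι
  field
    I        : ∀ {α} → Con α → D α
    I-interp : IsInterpretation I
    V        : Assignment → ∀ {γ} → Expr true γ → D γ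
    V-model  : IsValuation I V

module Submission where

-- The standard model over a one-point domain of individuals works. Excluded
-- middle decides the logical predicates (equality, is-var, is-con, is-expr^α),
-- and V is defined by structural recursion, where ⟦A⟧_B evaluates the eval-free
-- expression of type β denoted by the value of A when there is one and falls
-- back on B otherwise. Condition (6) holds because ℰ is injective, so that
-- expression is the only candidate.

open import Defs
open import Level using (0ℓ)
open import Axiom.ExcludedMiddle using (ExcludedMiddle)
open import Axiom.Extensionality.Propositional using (Extensionality)
open import Data.Bool using (true; false)
open import Data.Empty using (⊥-elim)
open import Data.Product using (Σ; _×_; _,_)
open import Data.Unit using (⊤; tt)
open import Function using (const; _$_)
open import Function.Bundles using (_⇔_; mk⇔)
open import Function.Definitions using (Injective)
open import Relation.Binary.PropositionalEquality
  using (_≡_; refl; sym; trans; cong; cong₂)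
open import Relation.Nullary using (Dec; does; yes; no)

does-true⇔ : {P : Set} (P? : Dec P) → (does P? ≡ true) ⇔ P
does-true⇔ (yes p) = mk⇔ (const p) (const refl)
does-true⇔ (no ¬p) = mk⇔ (λ ()) (λ p → ⊥-elim (¬p p))

module _ (Sym : Ty → Set) where
  open Lang Sym

  capp-injective : ∀ {A B A′ B′} → capp A B ≡ capp A′ B′ → A ≡ A′ × B ≡ B′
  capp-injective refl = refl , refl

  cabs-injective : ∀ {A B A′ B′} → cabs A B ≡ cabs A′ B′ → A ≡ A′ × B ≡ B′
  cabs-injective refl = refl , refl

  cquo-injective : ∀ {A A′} → cquo A ≡ cquo A′ → A ≡ A′
  cquo-injective refl = refl

  ℰ-injective-Σ : ∀ {α α′} (A : Expr false α) (A′ : Expr false α′) → ℰ A ≡ ℰ A′ →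
                  _≡_ {A = Σ Ty (Expr false)} (α , A) (α′ , A′)
  ℰ-injective-Σ (var _ _) (var _ _) refl = refl
  ℰ-injective-Σ (con _)   (con _)   refl = refl
  ℰ-injective-Σ (app F A) (app F′ A′) e
    with capp-injective e
  ... | eF , eA with ℰ-injective-Σ F F′ eF | ℰ-injective-Σ A A′ eA
  ...   | refl | refl = refl
  ℰ-injective-Σ (lam _ _ B) (lam _ _ B′) e
    with cabs-injective e
  ... | refl , eB with ℰ-injective-Σ B B′ eB
  ...   | refl = refl
  ℰ-injective-Σ (quo A) (quo A′) e
    with ℰ-injective-Σ A A′ (cquo-injective e)
  ... | refl = refl
  ℰ-injective-Σ (var _ _)   (con _)     ()
  ℰ-injective-Σ (var _ _)   (app _ _)   ()
  ℰ-injective-Σ (var _ _)   (lam _ _ _) ()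
  ℰ-injective-Σ (var _ _)   (quo _)     ()
  ℰ-injective-Σ (con _)     (var _ _)   ()
  ℰ-injective-Σ (con _)     (app _ _)   ()
  ℰ-injective-Σ (con _)     (lam _ _ _) ()
  ℰ-injective-Σ (con _)     (quo _)     ()
  ℰ-injective-Σ (app _ _)   (var _ _)   ()
  ℰ-injective-Σ (app _ _)   (con _)     ()
  ℰ-injective-Σ (app _ _)   (lam _ _ _) ()
  ℰ-injective-Σ (app _ _)   (quo _)     ()
  ℰ-injective-Σ (lam _ _ _) (var _ _)   ()
  ℰ-injective-Σ (lam _ _ _) (con _)     ()
  ℰ-injective-Σ (lam _ _ _) (app _ _)   ()
  ℰ-injective-Σ (lam _ _ _) (quo _)     ()
  ℰ-injective-Σ (quo _)     (var _ _)   ()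
  ℰ-injective-Σ (quo _)     (con _)     ()
  ℰ-injective-Σ (quo _)     (app _ _)   ()
  ℰ-injective-Σ (quo _)     (lam _ _ _) ()

  ℰ-injective : ∀ {α} → Injective _≡_ _≡_ (ℰ {α})
  ℰ-injective {x = A} {y = A′} e with ℰ-injective-Σ A A′ e
  ... | refl = refl

module StandardModel (em : ExcludedMiddle 0ℓ) (ext : Extensionality 0ℓ 0ℓ)
                     (Sym : Ty → Set) where
  open Lang Sym renaming (sym to nonlogical)
  open Frame ⊤

  inhabitant : (α : Ty) → D α
  inhabitant ι = tt
  inhabitant o = false
  inhabitant ε = qvar ι 0
  inhabitant (α ⇒ β) = const (inhabitant β)

  I : ∀ {α} → Con α → D α
  I (eqC α) x y = does (em {x ≡ y})
  I is-varC A = does (em {IsVar A})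
  I is-conC A = does (em {IsCon A})
  I appC = capp
  I absC = cabs
  I quoC = cquo
  I (is-exprC α) A = does (em {IsExpr α A})
  I {α} (nonlogical _) = inhabitant α

  I-isInterpretation : IsInterpretation I
  I-isInterpretation = record
    { eq-ok      = λ α x y → does-true⇔ em
    ; is-var-ok  = λ A → does-true⇔ em
    ; is-con-ok  = λ A → does-true⇔ em
    ; app-ok     = λ A B → refl
    ; abs-ok     = λ A B → refl
    ; quo-ok     = λ A → refl
    ; is-expr-ok = λ α A → does-true⇔ em
    }

  V-free : Assignment → ∀ {γ} → Expr false γ → D γ
  V-free φ (var α n) = φ α n
  V-free φ (con c) = I c
  V-free φ (app F A) = V-free φ F (V-free φ A)
  V-free φ (lam α n B) = λ d → V-free (update φ α n d) B
  V-free φ (quo A) = ℰ A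

  V : Assignment → ∀ {γ} → Expr true γ → D γ
  V φ (var α n) = φ α n
  V φ (con c) = I c
  V φ (app F A) = V φ F (V φ A)
  V φ (lam α n B) = λ d → V (update φ α n d) B
  V φ (quo A) = ℰ A
  V φ {β} (eval A B) with em {IsExpr β (V φ A)}
  ... | yes (C , _) = V-free φ C
  ... | no _ = V φ B

  V-embed : ∀ φ {γ} (C : Expr false γ) → V φ (embed C) ≡ V-free φ C
  V-embed φ (var α n) = refl
  V-embed φ (con c) = refl
  V-embed φ (app F A) = cong₂ _$_ (V-embed φ F) (V-embed φ A)
  V-embed φ (lam α n B) = ext λ d → V-embed (update φ α n d) B
  V-embed φ (quo A) = refl

  V-eval : ∀ φ {β} (A : Expr true ε) (B : Expr true β) (C : Expr false β) →
           ℰ C ≡ V φ A → V φ (eval A B) ≡ V φ (embed C)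
  V-eval φ {β} A B C e with em {IsExpr β (V φ A)}
  ... | yes (C′ , e′) = trans (cong (V-free φ) (ℰ-injective Sym (trans e′ (sym e))))
                              (sym (V-embed φ C))
  ... | no ¬expr = ⊥-elim (¬expr (C , e))

  V-isValuation : IsValuation I V
  V-isValuation = record
    { V-var  = λ φ α n → refl
    ; V-con  = λ φ c → refl
    ; V-app  = λ φ F A → refl
    ; V-lam  = λ φ α n B d → refl
    ; V-quo  = λ φ A → refl
    ; V-eval = λ φ A B _ → V-eval φ A B
    }

proposition1 : ExcludedMiddle 0ℓ → Extensionality 0ℓ 0ℓ →
    (Sym : Ty → Set) → Model Sym
proposition1 em ext Sym = record
  { Dι = ⊤ ; point = tt
  ; I = I ; I-interp = I-isInterpretation
  ; V = V ; V-model = V-isValuation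
  }
  where open StandardModel em ext Sym
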